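{- A position $(n_0,n_1,n_2,n_3,n_4,n_5)$ of ${\rm ECN}(6_{\{1,2\}},3)$ is a $\mathcal{P}$-position if and only if $n_0=n_3$, $n_1=n_4$ and $n_2=n_5$.
   Context: Extended circular nim ${\rm ECN}(m_S,k)$ (positive integers $k\le m$, $S$ a set of positive integers each at most $m/2$): there are $m$ piles $v_0,\dots,v_{m-1}$ arranged in a circle (indices mod $m$); a position is a tuple $(n_0,\dots,n_{m-1})$ of nonnegative integers, $n_i$ being the number of tokens on $v_i$. A move chooses $s\in S$, $i\in\{0,\dots,m-1\}$, $j\in\{0,\dots,k-1\}$ and removes an arbitrary nonnegative number of tokens from each pile $v_{(i+ts)\bmod m}$, $t=0,\dots,j$, removing at least one token in total (empty piles still count as piles). Normal play: the player unable to move loses. A $\mathcal{P}$-position is a position from which the previous player (the player who just moved) has a winning strategy. -}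

module Defs where

open import Data.Nat using (ℕ; _+_; _*_; _≤_; _<_; NonZero)
open import Data.Nat.DivMod using (_%_)
open import Data.Fin using (Fin; toℕ)
open import Data.List using (List)
open import Data.List.Membership.Propositional using (_∈_)
open import Data.Product using (Σ; ∃; _×_)
open import Relation.Binary.PropositionalEquality using (_≡_)
open import Relation.Nullary using (¬_)

Position : ℕ → Set
Position m = Fin m → ℕ

InBlock : (m : ℕ) → .{{_ : NonZero m}} → (s : ℕ) → Fin m → (j : ℕ) → Fin m → Set
InBlock m s i j l = ∃ λ t → t ≤ j × toℕ l ≡ (toℕ i + t * s) % m

Move : (m : ℕ) → .{{_ : NonZero m}} → (S : List ℕ) → (k : ℕ) →
       Position m → Position m → Set
Move m S k p q =
  Σ ℕ λ s → s ∈ S × Σ (Fin m) λ i → Σ ℕ λ j → j < k ×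
    ((l : Fin m) → q l ≤ p l) ×
    ((l : Fin m) → ¬ InBlock m s i j l → q l ≡ p l) ×
    (∃ λ l → q l < p l)

-- P- and N-positions (normal play), defined inductively: a position is a
-- P-position iff every move leads to an N-position; it is an N-position iff
-- some move leads to a P-position.  (Games are finite, so this is the
-- standard notion: the previous player has a winning strategy.)
mutual
  data IsP (m : ℕ) .{{nz : NonZero m}} (S : List ℕ) (k : ℕ) (p : Position m) : Set where
    isP : ((q : Position m) → Move m S k p q → IsN m S k q) → IsP m S k p

  data IsN (m : ℕ) .{{nz : NonZero m}} (S : List ℕ) (k : ℕ) (p : Position m) : Set where
    isN : (q : Position m) → Move m S k p q → IsP m S k q → IsN m S k p

{-# OPTIONS --safe #-}
module Submission where

-- The symmetric positions, p (l + 3) = p l, form a kernel of the move graph.  A block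
-- {i, i + s, i + 2s} with s ∈ {1, 2} never contains two opposite piles, so a move from a
-- symmetric position lowers some pile while freezing the opposite one, which breaks symmetry.
-- From an asymmetric position, lowering the larger pile of every opposite pair to the smaller
-- one is a single move: those larger piles contain no opposite pair, and every such set of
-- piles lies in a block of three.  Since every move removes tokens, an independent and
-- absorbing set of positions is exactly the set of P-positions.

open import Defs
open import Data.Bool.Base using (T)
open import Data.Fin.Base using (Fin; zero; suc; toℕ; fromℕ<)
open import Data.Fin.Properties as Fin using (all?; any?; ¬∀⟶∃¬)
open import Data.Fin.Subset using (Subset)
open import Data.Fin.Subset.Properties using (anySubset?)
open import Data.List.Base using (List; _∷_; [])
open import Data.List.Membership.Propositional using (_∈_; find; lose)
open import Data.List.Relation.Unary.All as All using (All)
open import Data.List.Relation.Unary.Any as Any using ()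
open import Data.Nat.Base
open import Data.Nat.DivMod using (_%_; m%n<n)
open import Data.Nat.Induction using (<-wellFounded)
open import Data.Nat.Properties
open import Data.Product as Product using (∃-syntax; ∄-syntax; _×_; _,_)
open import Data.Vec.Base using (lookup; tabulate; _∷_; [])
open import Data.Vec.Properties using (lookup∘tabulate)
open import Data.Vec.Functional using (foldr)
open import Function.Base using (_∘_; _on_)
open import Function.Bundles using (_⇔_; mk⇔; Equivalence)
open import Function.Construct.Composition using (_⇔-∘_)
open import Induction.WellFounded using (Acc; acc)
open import Level using (Level; 0ℓ)
open import Relation.Binary.Construct.On as On using ()
open import Relation.Binary.Definitions using (tri<; tri≈; tri>)
open import Relation.Binary.PropositionalEquality using (_≡_; sym; subst; module ≡-Reasoning)
open import Relation.Nullary.Decidable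
  using (Dec; isYes; map′; from-yes; from-no; decidable-stable; toWitness; fromWitness; T?;
         _×-dec_; _→-dec_; ¬?)
open import Relation.Nullary.Negation using (¬_; contradiction)
open import Relation.Unary using (Pred; Decidable)

private variable
  ℓ : Level

tokens : ∀ {m} → Position m → ℕ
tokens = foldr _+_ 0

tokens-mono-≤ : ∀ {m} (p q : Position m) → (∀ l → q l ≤ p l) → tokens q ≤ tokens p
tokens-mono-≤ {zero}  p q q≤p = z≤n
tokens-mono-≤ {suc m} p q q≤p =
  +-mono-≤ (q≤p zero) (tokens-mono-≤ (p ∘ suc) (q ∘ suc) (q≤p ∘ suc))

tokens-mono-< : ∀ {m} (p q : Position m) → (∀ l → q l ≤ p l) → ∃[ l ] q l < p l →
                tokens q < tokens p
tokens-mono-< {suc m} p q q≤p (zero , q<p) =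
  +-mono-<-≤ q<p (tokens-mono-≤ (p ∘ suc) (q ∘ suc) (q≤p ∘ suc))
tokens-mono-< {suc m} p q q≤p (suc l , q<p) =
  +-mono-≤-< (q≤p zero) (tokens-mono-< (p ∘ suc) (q ∘ suc) (q≤p ∘ suc) (l , q<p))

module _ {m : ℕ} .{{_ : NonZero m}} {S : List ℕ} {k : ℕ} where

  move-decreases-tokens : ∀ {p q} → Move m S k p q → tokens q < tokens p
  move-decreases-tokens {p} {q} (_ , _ , _ , _ , _ , q≤p , _ , lowered) =
    tokens-mono-< p q q≤p lowered

  IsP⇒¬IsN : ∀ {p} → IsP m S k p → ¬ IsN m S k p
  IsP⇒¬IsN (isP moves-to-N) (isN q move Pq) = IsP⇒¬IsN Pq (moves-to-N q move)

  IsP⇔kernel : (K : Pred (Position m) ℓ) → Decidable K →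
               (∀ {p q} → K p → Move m S k p q → ¬ K q) →
               (∀ {p} → ¬ K p → ∃[ q ] Move m S k p q × K q) →
               ∀ p → IsP m S k p ⇔ K p
  IsP⇔kernel K K? independent absorbing p = mk⇔ IsP⇒K (K⇒IsP (wf p))
    where
    _≺_ : Position m → Position m → Set
    _≺_ = _<_ on tokens

    wf : ∀ p → Acc _≺_ p
    wf = On.wellFounded tokens <-wellFounded

    mutual
      K⇒IsP : ∀ {p} → Acc _≺_ p → K p → IsP m S k p
      K⇒IsP (acc rs) Kp =
        isP λ q move → ¬K⇒IsN (rs (move-decreases-tokens move)) (independent Kp move)

      ¬K⇒IsN : ∀ {p} → Acc _≺_ p → ¬ K p → IsN m S k p
      ¬K⇒IsN (acc rs) ¬Kp with absorbing ¬Kp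
      ... | q , move , Kq = isN q move (K⇒IsP (rs (move-decreases-tokens move)) Kq)

    IsP⇒K : IsP m S k p → K p
    IsP⇒K Pp = decidable-stable (K? p) λ ¬Kp → IsP⇒¬IsN Pp (¬K⇒IsN (wf p) ¬Kp)

InBlock-mono : ∀ {m} .{{_ : NonZero m}} {s i j j′ l} → j ≤ j′ →
               InBlock m s i j l → InBlock m s i j′ l
InBlock-mono j≤j′ (t , t≤j , l≡) = t , ≤-trans t≤j j≤j′ , l≡

inBlock? : ∀ m .{{_ : NonZero m}} s i j → Decidable (InBlock m s i j)
inBlock? m s i j l =
  map′ (λ (t , t<1+j , l≡) → t , s≤s⁻¹ t<1+j , l≡) (λ (t , t≤j , l≡) → t , s≤s t≤j , l≡)
       (anyUpTo? (λ t → toℕ l ≟ (toℕ i + t * s) % m) (suc j))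

S : List ℕ
S = 1 ∷ 2 ∷ []

antipode : Fin 6 → Fin 6
antipode l = fromℕ< (m%n<n (toℕ l + 3) 6)

antipode-involutive : ∀ l → antipode (antipode l) ≡ l
antipode-involutive = from-yes (all? λ l → antipode (antipode l) Fin.≟ l)

blocks-antipode-free : All (λ s → ∀ i l → InBlock 6 s i 2 l → ¬ InBlock 6 s i 2 (antipode l)) S
blocks-antipode-free = from-yes (All.all? (λ s → all? λ i → all? λ l →
  inBlock? 6 s i 2 l →-dec ¬? (inBlock? 6 s i 2 (antipode l))) S)

block-antipode-free : ∀ {s j} → s ∈ S → j < 3 →
                      ∀ i l → InBlock 6 s i j l → ¬ InBlock 6 s i j (antipode l)
block-antipode-free {s} {j} s∈S j<3 i l l∈B l′∈B =
  All.lookup blocks-antipode-free s∈S i l (widen l∈B) (widen l′∈B)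
  where
  widen : ∀ {l} → InBlock 6 s i j l → InBlock 6 s i 2 l
  widen = InBlock-mono {s = s} {i} (s≤s⁻¹ j<3)

AntipodeFree : Pred (Fin 6) ℓ → Set ℓ
AntipodeFree R = ∀ l → R l → ¬ R (antipode l)

CoveredByBlock : Pred (Fin 6) ℓ → Set ℓ
CoveredByBlock R = ∃[ s ] s ∈ S × ∃[ i ] (∀ l → R l → InBlock 6 s i 2 l)

antipodeFree? : {R : Pred (Fin 6) ℓ} → Decidable R → Dec (AntipodeFree R)
antipodeFree? R? = all? λ l → R? l →-dec ¬? (R? (antipode l))

coveredByBlock? : {R : Pred (Fin 6) ℓ} → Decidable R → Dec (CoveredByBlock R)
coveredByBlock? R? = map′ find (λ (s , s∈S , covered) → lose s∈S covered)
  (Any.any? (λ s → any? λ i → all? λ l → R? l →-dec inBlock? 6 s i 2 l) S)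

Member : Subset 6 → Pred (Fin 6) 0ℓ
Member r l = T (lookup r l)

-- Exhaustive search over the 64 subsets of the hexagon: the antipode-free ones are the subsets
-- of the eight transversals, namely three consecutive piles or the alternate piles.
no-uncovered-antipode-free-subset : ∄[ r ] AntipodeFree (Member r) × ¬ CoveredByBlock (Member r)
no-uncovered-antipode-free-subset = from-no (anySubset? λ r →
  antipodeFree? (T? ∘ lookup r) ×-dec ¬? (coveredByBlock? (T? ∘ lookup r)))

antipodeFree⇒coveredByBlock : {R : Pred (Fin 6) ℓ} → Decidable R → AntipodeFree R → CoveredByBlock R
antipodeFree⇒coveredByBlock {R = R} R? free =
  let s , s∈S , i , covers = covered-r
  in  s , s∈S , i , λ l Rl → covers l (Equivalence.from (member⇔ l) Rl)
  where
  r : Subset 6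
  r = tabulate (isYes ∘ R?)

  member⇔ : ∀ l → Member r l ⇔ R l
  member⇔ l = mk⇔
    (λ l∈r → toWitness {a? = R? l} (subst T (lookup∘tabulate (isYes ∘ R?) l) l∈r))
    (λ Rl → subst T (sym (lookup∘tabulate (isYes ∘ R?) l)) (fromWitness {a? = R? l} Rl))

  free-r : AntipodeFree (Member r)
  free-r l l∈r l′∈r =
    free l (Equivalence.to (member⇔ l) l∈r) (Equivalence.to (member⇔ (antipode l)) l′∈r)

  covered-r : CoveredByBlock (Member r)
  covered-r = decidable-stable (coveredByBlock? (T? ∘ lookup r))
    λ uncovered → no-uncovered-antipode-free-subset (r , free-r , uncovered)

Symmetric : Position 6 → Set
Symmetric p = ∀ l → p (antipode l) ≡ p l

symmetric? : Decidable Symmetric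
symmetric? p = all? λ l → p (antipode l) ≟ p l

symmetric-independent : ∀ {p q} → Symmetric p → Move 6 S 3 p q → ¬ Symmetric q
symmetric-independent {p} {q} p-sym (s , s∈S , i , j , j<3 , _ , frozen , l , ql<pl) q-sym =
  <-irrefl ql≡pl ql<pl
  where
  antipode-frozen : ¬ InBlock 6 s i j (antipode l)
  antipode-frozen l′∈B =
    <-irrefl (frozen l λ l∈B → block-antipode-free s∈S j<3 i l l∈B l′∈B) ql<pl

  ql≡pl : q l ≡ p l
  ql≡pl = begin
    q l             ≡⟨ sym (q-sym l) ⟩
    q (antipode l)  ≡⟨ frozen (antipode l) antipode-frozen ⟩
    p (antipode l)  ≡⟨ p-sym l ⟩
    p l             ∎
    where open ≡-Reasoning

symmetrise : Position 6 → Position 6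
symmetrise p l = p l ⊓ p (antipode l)

symmetrise-symmetric : (p : Position 6) → Symmetric (symmetrise p)
symmetrise-symmetric p l rewrite antipode-involutive l = ⊓-comm (p (antipode l)) (p l)

descents-antipode-free : (p : Position 6) → AntipodeFree (λ l → p (antipode l) < p l)
descents-antipode-free p l descent descent′ =
  <-asym descent (subst (λ l″ → p l″ < p (antipode l)) (antipode-involutive l) descent′)

asymmetric⇒descent : {p : Position 6} → ¬ Symmetric p → ∃[ l ] p (antipode l) < p l
asymmetric⇒descent {p} asym with ¬∀⟶∃¬ 6 _ (λ l → p (antipode l) ≟ p l) asym
... | l , p′l≢pl with <-cmp (p (antipode l)) (p l)
...   | tri< p′l<pl _ _ = l , p′l<pl
...   | tri≈ _ p′l≡pl _ = contradiction p′l≡pl p′l≢pl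
...   | tri> _ _ pl<p′l =
  antipode l , subst (λ l″ → p l″ < p (antipode l)) (sym (antipode-involutive l)) pl<p′l

asymmetric⇒move-to-symmetrise : ∀ {p} → ¬ Symmetric p → Move 6 S 3 p (symmetrise p)
asymmetric⇒move-to-symmetrise {p} asym
  with antipodeFree⇒coveredByBlock (λ l → p (antipode l) <? p l) (descents-antipode-free p)
... | s , s∈S , i , descents-in-block =
  s , s∈S , i , 2 , ≤-refl , (λ l → m⊓n≤m (p l) (p (antipode l))) , frozen , lowered
  where
  frozen : ∀ l → ¬ InBlock 6 s i 2 l → symmetrise p l ≡ p l
  frozen l l∉B = m≤n⇒m⊓n≡m (≮⇒≥ (l∉B ∘ descents-in-block l))

  lowered : ∃[ l ] symmetrise p l < p l
  lowered = Product.map₂ (≤-<-trans (m⊓n≤n _ _)) (asymmetric⇒descent asym)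

symmetric⇔ : ∀ {n₀ n₁ n₂ n₃ n₄ n₅} →
  Symmetric (lookup (n₀ ∷ n₁ ∷ n₂ ∷ n₃ ∷ n₄ ∷ n₅ ∷ [])) ⇔ (n₀ ≡ n₃ × n₁ ≡ n₄ × n₂ ≡ n₅)
symmetric⇔ = mk⇔
  (λ p-sym → p-sym (suc (suc (suc zero))) , p-sym (suc (suc (suc (suc zero))))
           , p-sym (suc (suc (suc (suc (suc zero))))))
  equalities⇒symmetric
  where
  equalities⇒symmetric : ∀ {n₀ n₁ n₂ n₃ n₄ n₅} → n₀ ≡ n₃ × n₁ ≡ n₄ × n₂ ≡ n₅ →
                         Symmetric (lookup (n₀ ∷ n₁ ∷ n₂ ∷ n₃ ∷ n₄ ∷ n₅ ∷ []))
  equalities⇒symmetric (n₀≡n₃ , _ , _) zero = sym n₀≡n₃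
  equalities⇒symmetric (_ , n₁≡n₄ , _) (suc zero) = sym n₁≡n₄
  equalities⇒symmetric (_ , _ , n₂≡n₅) (suc (suc zero)) = sym n₂≡n₅
  equalities⇒symmetric (n₀≡n₃ , _ , _) (suc (suc (suc zero))) = n₀≡n₃
  equalities⇒symmetric (_ , n₁≡n₄ , _) (suc (suc (suc (suc zero)))) = n₁≡n₄
  equalities⇒symmetric (_ , _ , n₂≡n₅) (suc (suc (suc (suc (suc zero))))) = n₂≡n₅

mainTheorem3 : (n₀ n₁ n₂ n₃ n₄ n₅ : ℕ) →
    IsP 6 (1 ∷ 2 ∷ []) 3 (lookup (n₀ ∷ n₁ ∷ n₂ ∷ n₃ ∷ n₄ ∷ n₅ ∷ []))
      ⇔ (n₀ ≡ n₃ × n₁ ≡ n₄ × n₂ ≡ n₅)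
mainTheorem3 n₀ n₁ n₂ n₃ n₄ n₅ =
  symmetric⇔ ⇔-∘ IsP⇔kernel Symmetric symmetric? symmetric-independent
    (λ {p} asym → symmetrise p , asymmetric⇒move-to-symmetrise asym , symmetrise-symmetric p)
    (lookup (n₀ ∷ n₁ ∷ n₂ ∷ n₃ ∷ n₄ ∷ n₅ ∷ []))
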